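{- There is a finite semilattice $L$ such that $g_L(n)=\Omega(n)$.
   Context: A semilattice $L$ (a finite meet-semilattice) is regarded as an algebra with the two binary operations $\wedge$ and $\sqcup$. Here $a\sqcup b=a\vee b$ if the join $a\vee b$ exists, and $a\sqcup b=a\wedge b$ otherwise. The $n$-fold power $L^n$ is the algebra on $L^n$ with both operations applied componentwise. A subalgebra of $L^n$ is a subset $B$ closed under both operations. A generating set of $B$ is a subset $G\subseteq B$ such that every element of $B$ is obtained from elements of $G$ by iteratively applying the operations. $g_L^B(n)$ is the minimum cardinality of a generating set of $B$, and $g_L(n)=\max_B g_L^B(n)$ over all subalgebras $B$ of $L^n$. -}

module Defs where

open import Data.Nat using (ℕ)
open import Data.Fin using (Fin)
open import Data.Vec using (Vec; zipWith; []; _∷_)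
open import Data.Vec.Relation.Unary.All using (All)
open import Data.List using (List; length)
open import Data.List.Membership.Propositional using (_∈_)
open import Data.Product using (_×_; Σ)
open import Data.Sum using (_⊎_)
open import Relation.Nullary using (¬_)
open import Relation.Binary.PropositionalEquality using (_≡_)
open import Relation.Binary.Structures using (IsPartialOrder)
open import Relation.Binary.Lattice.Definitions using (Infimum)

-- A finite meet-semilattice: carrier Fin size (every finite set is in
-- bijection with some Fin size), a partial order, and a binary meet
-- (greatest lower bound).
record FinMeetSemilattice : Set₁ where
  field
    size           : ℕ
    _≤_            : Fin size → Fin size → Set
    isPartialOrder : IsPartialOrder _≡_ _≤_
    _∧_            : Fin size → Fin size → Fin size
    ∧-infimum      : Infimum _≤_ _∧_

  IsJoin : Fin size → Fin size → Fin size → Set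
  IsJoin x y z = (x ≤ z) × (y ≤ z) × (∀ w → x ≤ w → y ≤ w → z ≤ w)

  -- graph of the operation ⊔ : x ⊔ y = x ∨ y if the join exists,
  -- and x ⊔ y = x ∧ y otherwise.  (Functional and total.)
  SqGraph : Fin size → Fin size → Fin size → Set
  SqGraph x y z = IsJoin x y z ⊎ ((∀ w → ¬ IsJoin x y w) × (z ≡ x ∧ y))

module _ (L : FinMeetSemilattice) where
  open FinMeetSemilattice L

  Elt : ℕ → Set
  Elt n = Vec (Fin size) n

  _∧ⁿ_ : ∀ {n} → Elt n → Elt n → Elt n
  _∧ⁿ_ = zipWith _∧_

  data SqGraphⁿ : ∀ {n} → Elt n → Elt n → Elt n → Set where
    []  : SqGraphⁿ [] [] []
    _∷_ : ∀ {n a b c} {xs ys zs : Elt n} → SqGraph a b c →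
          SqGraphⁿ xs ys zs → SqGraphⁿ (a ∷ xs) (b ∷ ys) (c ∷ zs)

  IsSubalgebra : ∀ {n} → (Elt n → Set) → Set
  IsSubalgebra {n} B =
    (∀ x y → B x → B y → B (x ∧ⁿ y)) ×
    (∀ x y z → B x → B y → SqGraphⁿ x y z → B z)

  data Generated {n : ℕ} (G : List (Elt n)) : Elt n → Set where
    gen  : ∀ {x} → x ∈ G → Generated G x
    meet : ∀ {x y} → Generated G x → Generated G y → Generated G (x ∧ⁿ y)
    sq   : ∀ {x y z} → Generated G x → Generated G y → SqGraphⁿ x y z →
           Generated G z

  IsGeneratingSet : ∀ {n} → (Elt n → Set) → List (Elt n) → Set
  IsGeneratingSet B G =
    (∀ x → x ∈ G → B x) × (∀ x → B x → Generated G x)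

  -- AtLeastGen n t  means  t ≤ g_L(n) = max_B min_G |G| ;
  -- t ≤ g_L(n) = max_B min_G |G| :
  -- some subalgebra B of L^n has no generating set with fewer than t elements
  -- (lists with repetitions are only longer than the underlying set, so
  -- minimising length over lists equals minimising cardinality over sets)
  AtLeastGen : ℕ → ℕ → Set₁
  AtLeastGen n t = Σ (Elt n → Set) λ B → IsSubalgebra B ×
    (∀ G → IsGeneratingSet B G → t Data.Nat.≤ length G)

module Submission where

open import Defs
open import Data.Nat using (ℕ; _≤_; _*_)
open import Data.Product using (Σ; _×_)

-- The semilattice is V = {o, a, b} with o < a, o < b and a, b incomparable;
-- its only missing join is a ∨ b, so a ⊔ b = a ∧ b = o.  For each n the
-- subalgebra of V^n witnessing g_V(n) ≥ n consists of the vectors in which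
-- every pair of distinct coordinates (u, v) satisfies "u = a ⇒ v = b and
-- v = a ⇒ u = b"; it contains the vectors unit i (a at i, b elsewhere), and
-- every element has the letter a in at most one coordinate.

open import Data.Nat.Properties using (≤-reflexive; *-identityˡ)
open import Data.Fin using (Fin; _≟_)
open import Data.Fin.Properties using (all?; injective⇒≤)
open import Data.Vec using (lookup; tabulate)
open import Data.Vec.Properties using (lookup-zipWith; lookup∘tabulate)
open import Data.List using (List; length)
import Data.List as List
open import Data.List.Relation.Unary.Any as Any using (Any; index)
open import Data.List.Relation.Unary.Any.Properties using (lookup-index)
open import Data.List.Membership.Propositional using (_∈_)
open import Data.List.Membership.Propositional.Properties using (∈-lookup)
open import Data.Bool using (Bool; true; false; T; _∧_)
open import Data.Unit using (tt)
open import Data.Empty using (⊥-elim)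
open import Data.Sum using (_⊎_; inj₁; inj₂; [_,_])
open import Data.Product using (_,_)
open import Relation.Nullary using (¬_; Dec; yes; no)
open import Relation.Nullary.Decidable using (T?; _→-dec_; toWitness)
open import Relation.Binary.PropositionalEquality using (_≡_; _≢_; refl; sym; trans; subst; subst₂; isEquivalence)
open import Function using (_∘_)
open import Relation.Binary.Structures using (IsPartialOrder)

distinct-witnesses-bound : ∀ {n} {A : Set} {P : Fin n → A → Set} (xs : List A) →
  (w : ∀ i → Any (P i) xs) → (∀ {i j y} → y ∈ xs → P i y → P j y → i ≡ j) →
  n ≤ length xs
distinct-witnesses-bound {P = P} xs w exclusive = injective⇒≤ index-injective
  where
  index-injective : ∀ {i j} → index (w i) ≡ index (w j) → i ≡ j
  index-injective {i} {j} same =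
    exclusive (∈-lookup (index (w i))) (lookup-index (w i))
              (subst (P j ∘ List.lookup xs) (sym same) (lookup-index (w j)))

module General (L : FinMeetSemilattice) where
  open FinMeetSemilattice L using (size; IsJoin; SqGraph; isPartialOrder)
    renaming (_∧_ to _⊓_)
  open IsPartialOrder isPartialOrder using (antisym)

  join-unique : ∀ {x y z z′} → IsJoin x y z → IsJoin x y z′ → z ≡ z′
  join-unique (x≤z , y≤z , z-least) (x≤z′ , y≤z′ , z′-least) =
    antisym (z-least _ x≤z′ y≤z′) (z′-least _ x≤z y≤z)

  sq-functional : ∀ {x y z z′} → SqGraph x y z → SqGraph x y z′ → z ≡ z′
  sq-functional (inj₁ j) (inj₁ j′) = join-unique j j′
  sq-functional (inj₁ j) (inj₂ (no-join , _)) = ⊥-elim (no-join _ j)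
  sq-functional (inj₂ (no-join , _)) (inj₁ j′) = ⊥-elim (no-join _ j′)
  sq-functional (inj₂ (_ , z≡)) (inj₂ (_ , z′≡)) = trans z≡ (sym z′≡)

  lookup-sq : ∀ {n} {x y z : Elt L n} → SqGraphⁿ L x y z →
              ∀ i → SqGraph (lookup x i) (lookup y i) (lookup z i)
  lookup-sq (g ∷ _)  Fin.zero    = g
  lookup-sq (_ ∷ gs) (Fin.suc i) = lookup-sq gs i

  lookup-meet : ∀ {n} (x y : Elt L n) i →
                lookup (_∧ⁿ_ L x y) i ≡ lookup x i ⊓ lookup y i
  lookup-meet x y i = lookup-zipWith _⊓_ i x y

  Compatible : (Fin size → Fin size → Set) → Set
  Compatible R =
    (∀ {u v u′ v′} → R u v → R u′ v′ → R (u ⊓ u′) (v ⊓ v′)) ×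
    (∀ {u v u′ v′ w w′} → R u v → R u′ v′ →
       SqGraph u u′ w → SqGraph v v′ w′ → R w w′)

  PairwiseIn : ∀ {n} → (Fin size → Fin size → Set) → Elt L n → Set
  PairwiseIn R x = ∀ i j → i ≢ j → R (lookup x i) (lookup x j)

  pairwise-subalgebra : ∀ {n} {R : Fin size → Fin size → Set} →
                        Compatible R → IsSubalgebra L (PairwiseIn {n} R)
  pairwise-subalgebra {R = R} (meet-compat , sq-compat) =
    closed-meet , closed-sq
    where
    closed-meet : ∀ x y → PairwiseIn R x → PairwiseIn R y →
                  PairwiseIn R (_∧ⁿ_ L x y)
    closed-meet x y rx ry i j i≢j
      rewrite lookup-meet x y i | lookup-meet x y j =
      meet-compat (rx i j i≢j) (ry i j i≢j)

    closed-sq : ∀ x y z → PairwiseIn R x → PairwiseIn R y →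
                SqGraphⁿ L x y z → PairwiseIn R z
    closed-sq x y z rx ry g i j i≢j =
      sq-compat (rx i j i≢j) (ry i j i≢j) (lookup-sq g i) (lookup-sq g j)

  Prime : Fin size → Set
  Prime p =
    (∀ x y → x ⊓ y ≡ p → x ≡ p ⊎ y ≡ p) ×
    (∀ x y z → SqGraph x y z → z ≡ p → x ≡ p ⊎ y ≡ p)

  prime-witnessed : ∀ {n p} {G : List (Elt L n)} → Prime p →
                    ∀ {x} → Generated L G x → ∀ i → lookup x i ≡ p →
                    Any (λ g → lookup g i ≡ p) G
  prime-witnessed _ (gen x∈G) i xᵢ≡p = Any.map (λ { refl → xᵢ≡p }) x∈G
  prime-witnessed prime@(meet-prime , _) (meet {x} {y} gx gy) i zᵢ≡p =
    [ prime-witnessed prime gx i , prime-witnessed prime gy i ]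
      (meet-prime _ _ (trans (sym (lookup-meet x y i)) zᵢ≡p))
  prime-witnessed prime@(_ , sq-prime) (sq gx gy g) i zᵢ≡p =
    [ prime-witnessed prime gx i , prime-witnessed prime gy i ]
      (sq-prime _ _ _ (lookup-sq g i) zᵢ≡p)

  generators-lower-bound :
    ∀ {n p} {B : Elt L n → Set} → Prime p →
    (∀ i → Σ (Elt L n) λ x → B x × lookup x i ≡ p) →
    (∀ {x i j} → B x → lookup x i ≡ p → lookup x j ≡ p → i ≡ j) →
    ∀ G → IsGeneratingSet L B G → n ≤ length G
  generators-lower-bound {p = p} prime realised at-most-once G (G⊆B , generates) =
    distinct-witnesses-bound G witness
      (λ g∈G gᵢ≡p gⱼ≡p → at-most-once (G⊆B _ g∈G) gᵢ≡p gⱼ≡p)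
    where
    witness : ∀ i → Any (λ g → lookup g i ≡ p) G
    witness i with x , Bx , xᵢ≡p ← realised i =
      prime-witnessed prime (generates x Bx) i xᵢ≡p

V : Set
V = Fin 3

pattern o = Fin.zero
pattern a = Fin.suc Fin.zero
pattern b = Fin.suc (Fin.suc Fin.zero)

infix 4 _≼_
infixr 7 _⊓_
infixr 6 _⊔_

data _≼_ : V → V → Set where
  o≼     : ∀ {x} → o ≼ x
  ≼-refl : ∀ {x} → x ≼ x

≼-trans : ∀ {x y z} → x ≼ y → y ≼ z → x ≼ z
≼-trans o≼     _ = o≼
≼-trans ≼-refl q = q

≼-antisym : ∀ {x y} → x ≼ y → y ≼ x → x ≡ y
≼-antisym ≼-refl _      = refl
≼-antisym o≼     o≼     = refl
≼-antisym o≼     ≼-refl = refl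

≼-isPartialOrder : IsPartialOrder _≡_ _≼_
≼-isPartialOrder = record
  { isPreorder = record
    { isEquivalence = isEquivalence
    ; reflexive     = λ { refl → ≼-refl }
    ; trans         = ≼-trans
    }
  ; antisym = ≼-antisym
  }

_⊓_ : V → V → V
x ⊓ y with x ≟ y
... | yes _ = x
... | no  _ = o

⊓-lowerˡ : ∀ x y → x ⊓ y ≼ x
⊓-lowerˡ x y with x ≟ y
... | yes _ = ≼-refl
... | no  _ = o≼

⊓-lowerʳ : ∀ x y → x ⊓ y ≼ y
⊓-lowerʳ x y with x ≟ y
... | yes refl = ≼-refl
... | no  _    = o≼

⊓-greatest : ∀ {x y z} → z ≼ x → z ≼ y → z ≼ x ⊓ y
⊓-greatest o≼ _  = o≼
⊓-greatest _  o≼ = o≼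
⊓-greatest {z = z} ≼-refl ≼-refl with z ≟ z
... | yes _   = ≼-refl
... | no  z≢z = ⊥-elim (z≢z refl)

Vee : FinMeetSemilattice
Vee = record
  { size           = 3
  ; _≤_            = _≼_
  ; isPartialOrder = ≼-isPartialOrder
  ; _∧_            = _⊓_
  ; ∧-infimum      = λ x y → ⊓-lowerˡ x y , ⊓-lowerʳ x y , λ _ → ⊓-greatest
  }

open FinMeetSemilattice Vee using (IsJoin; SqGraph)
open General Vee using (sq-functional; Compatible; PairwiseIn; pairwise-subalgebra;
                        Prime; generators-lower-bound)

_⊔_ : V → V → V
o ⊔ y = y
x ⊔ o = x
x ⊔ y = x ⊓ y

no-join-ab : ∀ w → ¬ IsJoin a b w
no-join-ab o (() , _)
no-join-ab a (_ , () , _)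
no-join-ab b (() , _)

no-join-ba : ∀ w → ¬ IsJoin b a w
no-join-ba o (() , _)
no-join-ba a (() , _)
no-join-ba b (_ , () , _)

⊔-spec : ∀ x y → SqGraph x y (x ⊔ y)
⊔-spec o y = inj₁ (o≼ , ≼-refl , λ _ _ y≼w → y≼w)
⊔-spec a o = inj₁ (≼-refl , o≼ , λ _ x≼w _ → x≼w)
⊔-spec b o = inj₁ (≼-refl , o≼ , λ _ x≼w _ → x≼w)
⊔-spec a a = inj₁ (≼-refl , ≼-refl , λ _ x≼w _ → x≼w)
⊔-spec b b = inj₁ (≼-refl , ≼-refl , λ _ x≼w _ → x≼w)
⊔-spec a b = inj₂ (no-join-ab , refl)
⊔-spec b a = inj₂ (no-join-ba , refl)

SqGraph⇒⊔ : ∀ {x y z} → SqGraph x y z → z ≡ x ⊔ y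
SqGraph⇒⊔ {x} {y} g = sq-functional g (⊔-spec x y)

⊓-prime : ∀ x y → x ⊓ y ≡ a → x ≡ a ⊎ y ≡ a
⊓-prime x y eq with x ≟ y
⊓-prime x y eq | yes _ = inj₁ eq
⊓-prime x y () | no  _

⊔-prime : ∀ x y → x ⊔ y ≡ a → x ≡ a ⊎ y ≡ a
⊔-prime o _ eq = inj₂ eq
⊔-prime a _ _  = inj₁ refl
⊔-prime b o ()
⊔-prime b a ()
⊔-prime b b ()

a-prime : Prime a
a-prime = ⊓-prime , λ x y z g z≡a → ⊔-prime x y (trans (sym (SqGraph⇒⊔ g)) z≡a)

a⇒bᵇ : V → V → Bool
a⇒bᵇ a b = true
a⇒bᵇ a _ = false
a⇒bᵇ _ _ = true

R : V → V → Set
R u v = T (a⇒bᵇ u v ∧ a⇒bᵇ v u)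

Preserves : (V → V → V) → Set
Preserves _∙_ = ∀ u v u′ v′ → R u v → R u′ v′ → R (u ∙ u′) (v ∙ v′)

-- Preservation is a finite property of V, decided by exhaustive evaluation.
preserves? : ∀ _∙_ → Dec (Preserves _∙_)
preserves? _∙_ =
  all? λ u → all? λ v → all? λ u′ → all? λ v′ →
    T? _ →-dec (T? _ →-dec T? _)

R-compatible : Compatible R
R-compatible = (λ {u v u′ v′} → ⊓-preserves u v u′ v′) , ⊔-compatible
  where
  ⊓-preserves : Preserves _⊓_
  ⊓-preserves = toWitness {a? = preserves? _⊓_} tt

  ⊔-preserves : Preserves _⊔_
  ⊔-preserves = toWitness {a? = preserves? _⊔_} tt

  ⊔-compatible : ∀ {u v u′ v′ w w′} → R u v → R u′ v′ →
                 SqGraph u u′ w → SqGraph v v′ w′ → R w w′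
  ⊔-compatible {u} {v} {u′} {v′} r r′ g g′
    rewrite SqGraph⇒⊔ g | SqGraph⇒⊔ g′ = ⊔-preserves u v u′ v′ r r′

Spread : ∀ {n} → Elt Vee n → Set
Spread = PairwiseIn R

a-at-most-once : ∀ {n} {x : Elt Vee n} {i j} → Spread x →
                 lookup x i ≡ a → lookup x j ≡ a → i ≡ j
a-at-most-once {i = i} {j} spread xᵢ≡a xⱼ≡a with i ≟ j
... | yes i≡j = i≡j
... | no  i≢j = ⊥-elim (subst₂ R xᵢ≡a xⱼ≡a (spread i j i≢j))

spike : ∀ {n} → Fin n → Fin n → V
spike i j with i ≟ j
... | yes _ = a
... | no  _ = b

unit : ∀ {n} → Fin n → Elt Vee n
unit i = tabulate (spike i)

unit-at : ∀ {n} (i : Fin n) → lookup (unit i) i ≡ a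
unit-at i rewrite lookup∘tabulate (spike i) i with i ≟ i
... | yes _   = refl
... | no  i≢i = ⊥-elim (i≢i refl)

unit-spread : ∀ {n} (i : Fin n) → Spread (unit i)
unit-spread i j k j≢k
  rewrite lookup∘tabulate (spike i) j | lookup∘tabulate (spike i) k
  with i ≟ j | i ≟ k
... | yes refl | yes refl = ⊥-elim (j≢k refl)
... | yes _    | no  _    = tt
... | no  _    | yes _    = tt
... | no  _    | no  _    = tt

-- g_V(n) ≥ n for every n (k = 1, N = 0, t = n): Spread is a subalgebra, and
-- the prime a occurs at every coordinate of Spread but at most once per element.
theorem3p2 : Σ FinMeetSemilattice λ L → Σ ℕ λ k → Σ ℕ λ N →
    ∀ n → N ≤ n → Σ ℕ λ t → (n ≤ k * t) × AtLeastGen L n t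
theorem3p2 = Vee , 1 , 0 , λ n _ →
  n , ≤-reflexive (sym (*-identityˡ n)) ,
  Spread , pairwise-subalgebra R-compatible ,
  generators-lower-bound a-prime (λ i → unit i , unit-spread i , unit-at i)
                         (λ {x} → a-at-most-once {x = x})
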